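{- There exists a constant $\beta>0$ such that for all sufficiently large $X$, \[ \#\{1\leq n\leq X:\ \sigma moex(n)\text{ is odd}\}\geq \beta\log\log X . \]
   Context: For a partition $\pi$ of a positive integer $n$, $moex(\pi)$ is the smallest odd positive integer that is not a part of $\pi$. For a positive integer $n$, $\sigma moex(n)=\sum_{\pi} moex(\pi)$, summed over all partitions $\pi$ of $n$, and $\sigma moex(0)=1$. Equivalently, $\sum_{n\geq 0}\sigma moex(n)q^n=(-q;q)_\infty(-q;q^2)_\infty^2$, where $(a;q)_\infty=\prod_{m\geq 1}(1-aq^{m-1})$. -}

module Defs where

open import Data.Nat using (ℕ; zero; suc; _+_; _*_; _∸_; _≤?_; _≡ᵇ_; _%_)
open import Data.Nat.Properties using (_≟_)
open import Data.Bool using (Bool; true; false; if_then_else_)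
open import Data.List using (List; []; _∷_; _++_; map; concatMap; filter; upTo; replicate; length)
open import Data.Nat.ListAction using (sum)
open import Data.Bool.ListAction using (any)

-- partsUpTo m n : all partitions of n whose parts are all ≤ m, each listed
-- exactly once as a non-increasing list of positive parts.
partsUpTo : ℕ → ℕ → List (List ℕ)
partsUpTo zero zero = [] ∷ []
partsUpTo zero (suc n) = []
partsUpTo (suc m) n =
  concatMap (λ k → map (λ π → replicate k (suc m) ++ π) (partsUpTo m (n ∸ k * suc m)))
            (filter (λ k → k * suc m ≤? n) (upTo (suc n)))

partitions : ℕ → List (List ℕ)
partitions n = partsUpTo n n

moexSearch : ℕ → ℕ → List ℕ → ℕ
moexSearch zero c π = c
moexSearch (suc f) c π = if any (λ x → x ≡ᵇ c) π then moexSearch f (2 + c) π else c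

-- moex π = smallest odd positive integer not a part of π
-- (fuel length π suffices: π has at most length π distinct odd parts)
moex : List ℕ → ℕ
moex π = moexSearch (length π) 1 π

σmoex : ℕ → ℕ
σmoex n = sum (map moex (partitions n))

oddCount : ℕ → ℕ
oddCount X = length (filter (λ n → σmoex n % 2 ≟ 1) (map suc (upTo X)))

-- Since moex π is always odd, σmoex n ≡ p(n) (mod 2) for the partition function p.  Over 𝔽₂ the
-- signs in Shanks' finite form of Euler's pentagonal number theorem disappear; it is proved by
-- telescoping in n and applied to the series of partitions into parts ≤ m, which satisfy
-- (1 + q^(m+1)) · Σₖ p≤(m+1)(k) qᵏ = Σₖ p≤(m)(k) qᵏ.  The outcome is the recurrence
-- Σ p(n − g) ≡ 0 (mod 2) for n ≥ 1, over the pentagonal numbers g ≤ n.  At n = W = (N+1)(3N+4)/2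
-- every term except p(0) = 1 is p(m) with N < m ≤ W, so p is odd somewhere in (N, W].  As
-- W = O(N²), iterating N ↦ W puts an odd value of p into each of ≫ log log X disjoint intervals
-- below X.

{-# OPTIONS --safe #-}
module Submission where

open import Defs
open import Data.Nat using (ℕ; _*_; _≤_; _<_)
open import Data.Nat.Logarithm using (⌊log₂_⌋)
open import Data.Product using (∃-syntax; _×_; _,_)

open import Data.Bool using (true; false; if_then_else_)
open import Data.Bool.ListAction using (any)
open import Data.List using (List; []; _∷_; _++_; [_]; _∷ʳ_; map; concatMap; filter; upTo; applyUpTo; length; replicate)
open import Data.List.Properties using (length-++; length-map; map-cong; map-upTo; map-++; upTo-∷ʳ; filter-++)
open import Data.Nat using (zero; suc; _+_; _∸_; _^_; _%_; _≡ᵇ_; z≤n; s≤s; z<s; _≤?_; _≤′_; ≤′-refl; ≤′-step; parity)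
open import Data.Nat.DivMod using ([m+n]%n≡m%n)
open import Data.Nat.ListAction using (sum)
open import Data.Nat.Logarithm using (⌊log₂⌋-mono-≤; ⌊log₂[2^n]⌋≡n)
open import Data.Nat.Properties
open import Data.Nat.Solver using (module +-*-Solver)
open +-*-Solver using (solve; _:=_; _:+_; _:*_; con)
open import Data.Parity.Base using (Parity; 0ℙ; 1ℙ) renaming (_+_ to _+ℙ_)
import Data.Parity.Properties as ℙ
open import Algebra.Properties.AbelianGroup ℙ.+-0-abelianGroup using (xyx⁻¹≈y)
open import Algebra.Properties.CommutativeSemigroup ℙ.+-commutativeSemigroup using (interchange)
open import Function using (_∘_)
open import Relation.Binary.PropositionalEquality hiding ([_])
open import Relation.Nullary using (¬_; does; yes; no; contradiction)
open import Relation.Nullary.Decidable using (dec-true; dec-false)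
open import Relation.Unary using (Pred; Decidable)

-- Power series over 𝔽₂

x+y+y≡x : ∀ x y → x +ℙ y +ℙ y ≡ x
x+y+y≡x x y = trans (ℙ.+-assoc x y y) (trans (cong (x +ℙ_) (ℙ.p+p≡0ℙ y)) (ℙ.+-identityʳ x))

x+y≡z⇒x≡y+z : ∀ x y {z} → x +ℙ y ≡ z → x ≡ y +ℙ z
x+y≡z⇒x≡y+z x y {z} eq = trans (sym (x+y+y≡x x y)) (trans (cong (_+ℙ y) eq) (ℙ.+-comm z y))

x+y+[y+z+x]≡z : ∀ x y z → (x +ℙ y) +ℙ ((y +ℙ z) +ℙ x) ≡ z
x+y+[y+z+x]≡z 0ℙ 0ℙ 0ℙ = refl
x+y+[y+z+x]≡z 0ℙ 0ℙ 1ℙ = refl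
x+y+[y+z+x]≡z 0ℙ 1ℙ 0ℙ = refl
x+y+[y+z+x]≡z 0ℙ 1ℙ 1ℙ = refl
x+y+[y+z+x]≡z 1ℙ 0ℙ 0ℙ = refl
x+y+[y+z+x]≡z 1ℙ 0ℙ 1ℙ = refl
x+y+[y+z+x]≡z 1ℙ 1ℙ 0ℙ = refl
x+y+[y+z+x]≡z 1ℙ 1ℙ 1ℙ = refl

Series : Set
Series = ℕ → Parity

infix 4 _≈_
_≈_ : Series → Series → Set
f ≈ g = ∀ n → f n ≡ g n

infixl 6 _⊕_
_⊕_ : Series → Series → Series
(f ⊕ g) n = f n +ℙ g n

shift : ℕ → Series → Series
shift zero    f = f
shift (suc k) f zero    = 0ℙ
shift (suc k) f (suc n) = shift k f n

shift-cong : ∀ k {f g} → f ≈ g → shift k f ≈ shift k g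
shift-cong zero    f≈g n       = f≈g n
shift-cong (suc k) f≈g zero    = refl
shift-cong (suc k) f≈g (suc n) = shift-cong k f≈g n

shift-⊕ : ∀ k f g → shift k (f ⊕ g) ≈ shift k f ⊕ shift k g
shift-⊕ zero    f g n       = refl
shift-⊕ (suc k) f g zero    = refl
shift-⊕ (suc k) f g (suc n) = shift-⊕ k f g n

shift-+ : ∀ a b f → shift (a + b) f ≈ shift a (shift b f)
shift-+ zero    b f n       = refl
shift-+ (suc a) b f zero    = refl
shift-+ (suc a) b f (suc n) = shift-+ a b f n

shift-comm : ∀ a b f → shift a (shift b f) ≈ shift b (shift a f)
shift-comm a b f n = begin
  shift a (shift b f) n  ≡⟨ shift-+ a b f n ⟨
  shift (a + b) f n      ≡⟨ cong (λ e → shift e f n) (+-comm a b) ⟩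
  shift (b + a) f n      ≡⟨ shift-+ b a f n ⟩
  shift b (shift a f) n  ∎
  where open ≡-Reasoning

shift-< : ∀ k f {n} → n < k → shift k f n ≡ 0ℙ
shift-< (suc k) f {zero}  _         = refl
shift-< (suc k) f {suc n} (s≤s n<k) = shift-< k f n<k

shift-≥ : ∀ k f {n} → k ≤ n → shift k f n ≡ f (n ∸ k)
shift-≥ zero    f _         = refl
shift-≥ (suc k) f (s≤s k≤n) = shift-≥ k f k≤n

shift-+-apply : ∀ k f r → shift k f (k + r) ≡ f r
shift-+-apply zero    f r = refl
shift-+-apply (suc k) f r = shift-+-apply k f r

infixr 7 [1+q^_]*_
[1+q^_]*_ : ℕ → Series → Series
[1+q^ i ]* f = f ⊕ shift i f

[1+q^]-cong : ∀ i {f g} → f ≈ g → [1+q^ i ]* f ≈ [1+q^ i ]* g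
[1+q^]-cong i f≈g n = cong₂ _+ℙ_ (f≈g n) (shift-cong i f≈g n)

[1+q^]-comm : ∀ i j f → [1+q^ i ]* [1+q^ j ]* f ≈ [1+q^ j ]* [1+q^ i ]* f
[1+q^]-comm i j f n = begin
  (f n +ℙ shift j f n) +ℙ shift i (f ⊕ shift j f) n
    ≡⟨ cong (f n +ℙ shift j f n +ℙ_) (shift-⊕ i f (shift j f) n) ⟩
  (f n +ℙ shift j f n) +ℙ (shift i f n +ℙ shift i (shift j f) n)
    ≡⟨ interchange (f n) (shift j f n) (shift i f n) (shift i (shift j f) n) ⟩
  (f n +ℙ shift i f n) +ℙ (shift j f n +ℙ shift i (shift j f) n)
    ≡⟨ cong (λ x → f n +ℙ shift i f n +ℙ (shift j f n +ℙ x)) (shift-comm i j f n) ⟩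
  (f n +ℙ shift i f n) +ℙ (shift j f n +ℙ shift j (shift i f) n)
    ≡⟨ cong (f n +ℙ shift i f n +ℙ_) (shift-⊕ j f (shift i f) n) ⟨
  (f n +ℙ shift i f n) +ℙ shift j (f ⊕ shift i f) n
    ∎
  where open ≡-Reasoning

poch : ℕ → ℕ → Series → Series
poch k zero    f = f
poch k (suc d) f = [1+q^ suc k ]* poch (suc k) d f

poch-cong : ∀ k d {f g} → f ≈ g → poch k d f ≈ poch k d g
poch-cong k zero    f≈g = f≈g
poch-cong k (suc d) f≈g = [1+q^]-cong (suc k) (poch-cong (suc k) d f≈g)

poch-last : ∀ k d f → poch k (suc d) f ≈ [1+q^ k + suc d ]* poch k d f
poch-last k zero    f n = cong (λ e → ([1+q^ e ]* f) n) (+-comm 1 k)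
poch-last k (suc d) f n = begin
  ([1+q^ suc k ]* poch (suc k) (suc d) f) n
    ≡⟨ [1+q^]-cong (suc k) (poch-last (suc k) d f) n ⟩
  ([1+q^ suc k ]* [1+q^ suc k + suc d ]* poch (suc k) d f) n
    ≡⟨ [1+q^]-comm (suc k) (suc k + suc d) (poch (suc k) d f) n ⟩
  ([1+q^ suc k + suc d ]* poch k (suc d) f) n
    ≡⟨ cong (λ e → ([1+q^ e ]* poch k (suc d) f) n) (+-suc k (suc d)) ⟨
  ([1+q^ k + suc (suc d) ]* poch k (suc d) f) n
    ∎
  where open ≡-Reasoning

⨁ : ℕ → (ℕ → Series) → Series
⨁ zero    g n = 0ℙ
⨁ (suc m) g   = ⨁ m g ⊕ g m

⨁-⊕ : ∀ m g h → ⨁ m (λ k → g k ⊕ h k) ≈ ⨁ m g ⊕ ⨁ m h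
⨁-⊕ zero    g h n = refl
⨁-⊕ (suc m) g h n = trans (cong (_+ℙ (g m n +ℙ h m n)) (⨁-⊕ m g h n))
                          (interchange (⨁ m g n) (⨁ m h n) (g m n) (h m n))

-- Shanks' identity modulo 2

tri : ℕ → ℕ
tri zero    = 0
tri (suc k) = suc k + tri k

-- pent⁻ k and pent⁺ k are the pentagonal numbers j(3j − 1)/2 and j(3j + 1)/2 for j = k + 1.
pent⁻ pent⁺ : ℕ → ℕ
pent⁻ k = suc k * suc k + tri k
pent⁺ k = suc k * suc k + tri (suc k)

pentagonalSum : ℕ → Series → Series
pentagonalSum zero    f = f
pentagonalSum (suc n) f = pentagonalSum n f ⊕ (shift (pent⁻ n) f ⊕ shift (pent⁺ n) f)

-- Shanks' identity Σ_{k ≤ n} (−1)ᵏ q^(kn + k(k+1)/2) (q^(k+1); q)_(n−k)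
--   = 1 + Σ_{1 ≤ j ≤ n} (−1)ʲ (q^(j(3j−1)/2) + q^(j(3j+1)/2)), read modulo 2 where the signs disappear.
shanksTerm : ℕ → ℕ → Series → Series
shanksTerm n k f = shift (k * n + tri k) (poch k (n ∸ k) f)

shanksSum : ℕ → Series → Series
shanksSum n f = ⨁ (suc n) (λ k → shanksTerm n k f)

m∸n≡1+[m∸1+n] : ∀ {m n} → suc n ≤ m → m ∸ n ≡ suc (m ∸ suc n)
m∸n≡1+[m∸1+n] = +-∸-assoc 1

shanksDiff : ℕ → ℕ → Series → Series
shanksDiff n K f = shift (K * suc n + tri K + suc n) (poch K (n ∸ K) f)

shanksDiff-split : ∀ n K f → suc K ≤ n →
  shanksDiff n K f ≈ shanksTerm n (suc K) f ⊕ shift (suc K * suc n + tri (suc K)) (poch (suc K) (n ∸ suc K) f)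
shanksDiff-split n K f k≤n j = begin
  shift e (poch K (n ∸ K) f) j
    ≡⟨ cong (λ d′ → shift e (poch K d′ f) j) (m∸n≡1+[m∸1+n] k≤n) ⟩
  shift e (Q ⊕ shift k Q) j
    ≡⟨ shift-⊕ e Q (shift k Q) j ⟩
  shift e Q j +ℙ shift e (shift k Q) j
    ≡⟨ cong₂ _+ℙ_ (cong (λ e′ → shift e′ Q j) e≡)
                  (trans (sym (shift-+ e k Q j)) (cong (λ e′ → shift e′ Q j) e+k≡)) ⟩
  shift (k * n + tri k) Q j +ℙ shift (k * suc n + tri k) Q j
    ∎
  where
  open ≡-Reasoning
  k = suc K
  Q = poch k (n ∸ k) f
  e = K * suc n + tri K + suc n
  e≡ : e ≡ k * n + tri k
  e≡ = solve 3 (λ K n t → K :* (con 1 :+ n) :+ t :+ (con 1 :+ n)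
                       := (con 1 :+ K) :* n :+ ((con 1 :+ K) :+ t)) refl K n (tri K)
  e+k≡ : e + k ≡ k * suc n + tri k
  e+k≡ = solve 3 (λ K n t → K :* (con 1 :+ n) :+ t :+ (con 1 :+ n) :+ (con 1 :+ K)
                         := (con 1 :+ K) :* (con 1 :+ n) :+ ((con 1 :+ K) :+ t)) refl K n (tri K)

shanksTerm-split : ∀ n K f → suc K ≤ n →
  shanksTerm (suc n) (suc K) f ≈ shift (suc K * suc n + tri (suc K)) (poch (suc K) (n ∸ suc K) f) ⊕ shanksDiff n (suc K) f
shanksTerm-split n K f k≤n j = begin
  shift e (poch k (n ∸ K) f) j
    ≡⟨ cong (λ d′ → shift e (poch k d′ f) j) (m∸n≡1+[m∸1+n] k≤n) ⟩
  shift e (poch k (suc d) f) j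
    ≡⟨ shift-cong e (poch-last k d f) j ⟩
  shift e ([1+q^ k + suc d ]* Q) j
    ≡⟨ cong (λ i → shift e ([1+q^ i ]* Q) j) (trans (+-suc k d) (cong suc (m+[n∸m]≡n k≤n))) ⟩
  shift e (Q ⊕ shift (suc n) Q) j
    ≡⟨ shift-⊕ e Q (shift (suc n) Q) j ⟩
  shift e Q j +ℙ shift e (shift (suc n) Q) j
    ≡⟨ cong (shift e Q j +ℙ_) (shift-+ e (suc n) Q j) ⟨
  shift e Q j +ℙ shanksDiff n k f j
    ∎
  where
  open ≡-Reasoning
  k = suc K
  d = n ∸ k
  Q = poch k d f
  e = k * suc n + tri k

shanks-telescope : ∀ n K f → K ≤ n →
  ⨁ (suc K) (λ k → shanksTerm (suc n) k f ⊕ shanksTerm n k f) ≈ shanksDiff n K f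
shanks-telescope n zero    f _   j =
  trans (cong (_+ℙ poch 0 n f j) (poch-last 0 n f j))
        (xyx⁻¹≈y (poch 0 n f j) (shift (suc n) (poch 0 n f) j))
shanks-telescope n (suc K) f k≤n j = begin
  ⨁ (suc K) (λ i → shanksTerm (suc n) i f ⊕ shanksTerm n i f) j +ℙ (shanksTerm (suc n) k f j +ℙ x)
    ≡⟨ cong₂ (λ u v → u +ℙ (v +ℙ x))
             (trans (shanks-telescope n K f (<⇒≤ k≤n) j) (shanksDiff-split n K f k≤n j))
             (shanksTerm-split n K f k≤n j) ⟩
  (x +ℙ y) +ℙ ((y +ℙ shanksDiff n k f j) +ℙ x)
    ≡⟨ x+y+[y+z+x]≡z x y (shanksDiff n k f j) ⟩
  shanksDiff n k f j
    ∎
  where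
  open ≡-Reasoning
  k = suc K
  x = shanksTerm n k f j
  y = shift (k * suc n + tri k) (poch k (n ∸ k) f) j

shanks : ∀ n f → shanksSum n f ≈ pentagonalSum n f
shanks zero    f j = refl
shanks (suc n) f j = begin
  ⨁ N (λ k → shanksTerm N k f) j +ℙ shanksTerm N N f j
    ≡⟨ cong₂ _+ℙ_ (x+y≡z⇒x≡y+z (⨁ N (λ k → shanksTerm N k f) j) (shanksSum n f j) telescoped) last≡pent⁺ ⟩
  (shanksSum n f j +ℙ shanksDiff n n f j) +ℙ shift (pent⁺ n) f j
    ≡⟨ cong₂ (λ u v → u +ℙ v +ℙ shift (pent⁺ n) f j) (shanks n f j) diff≡pent⁻ ⟩
  pentagonalSum n f j +ℙ shift (pent⁻ n) f j +ℙ shift (pent⁺ n) f j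
    ≡⟨ ℙ.+-assoc (pentagonalSum n f j) (shift (pent⁻ n) f j) (shift (pent⁺ n) f j) ⟩
  pentagonalSum (suc n) f j
    ∎
  where
  open ≡-Reasoning
  N = suc n
  telescoped : ⨁ N (λ k → shanksTerm N k f) j +ℙ shanksSum n f j ≡ shanksDiff n n f j
  telescoped = trans (sym (⨁-⊕ N (λ k → shanksTerm N k f) (λ k → shanksTerm n k f) j))
                     (shanks-telescope n n f ≤-refl j)
  last≡pent⁺ : shanksTerm N N f j ≡ shift (pent⁺ n) f j
  last≡pent⁺ = cong (λ d → shift (pent⁺ n) (poch N d f) j) (n∸n≡0 n)
  diff≡pent⁻ : shanksDiff n n f j ≡ shift (pent⁻ n) f j
  diff≡pent⁻ = cong₂ (λ e d → shift e (poch n d f) j) (exponent-pent⁻ n (tri n)) (n∸n≡0 n)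
    where
    exponent-pent⁻ : ∀ n t → n * suc n + t + suc n ≡ suc n * suc n + t
    exponent-pent⁻ = solve 2 (λ n t → n :* (con 1 :+ n) :+ t :+ (con 1 :+ n)
                                     := (con 1 :+ n) :* (con 1 :+ n) :+ t) refl

shanksSum-low : ∀ n f {j} → j ≤ n → shanksSum n f j ≡ poch 0 n f j
shanksSum-low n f {j} j≤n = low n
  where
  low : ∀ m → ⨁ (suc m) (λ k → shanksTerm n k f) j ≡ poch 0 n f j
  low zero    = refl
  low (suc m) = begin
    ⨁ (suc m) (λ k → shanksTerm n k f) j +ℙ shanksTerm n (suc m) f j
      ≡⟨ cong₂ _+ℙ_ (low m) (shift-< (suc m * n + tri (suc m)) _ j<e) ⟩
    poch 0 n f j +ℙ 0ℙ
      ≡⟨ ℙ.+-identityʳ _ ⟩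
    poch 0 n f j
      ∎
    where
    open ≡-Reasoning
    j<e : j < n + m * n + (suc m + tri m)
    j<e = ≤-<-trans (≤-trans j≤n (m≤m+n n (m * n))) (m<m+n _ z<s)

-- Partitions with bounded parts

length-concatMap-filter : ∀ {a b p} {A : Set a} {B : Set b} {P : Pred A p}
  (P? : Decidable P) (G : A → List B) xs →
  length (concatMap G (filter P? xs)) ≡ sum (map (λ x → if does (P? x) then length (G x) else 0) xs)
length-concatMap-filter P? G []       = refl
length-concatMap-filter P? G (x ∷ xs) with does (P? x)
... | false = length-concatMap-filter P? G xs
... | true  = trans (length-++ (G x)) (cong (length (G x) +_) (length-concatMap-filter P? G xs))

sum-applyUpTo-cong : ∀ {g h} L → (∀ k → g k ≡ h k) → sum (applyUpTo g L) ≡ sum (applyUpTo h L)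
sum-applyUpTo-cong zero    g≡h = refl
sum-applyUpTo-cong (suc L) g≡h = cong₂ _+_ (g≡h 0) (sum-applyUpTo-cong L (g≡h ∘ suc))

sum-applyUpTo-truncate : ∀ h B L → (∀ k → B ≤ k → h k ≡ 0) → B ≤ L →
                         sum (applyUpTo h L) ≡ sum (applyUpTo h B)
sum-applyUpTo-truncate h zero    zero    vanish _ = refl
sum-applyUpTo-truncate h zero    (suc L) vanish _ =
  cong₂ _+_ (vanish 0 z≤n) (sum-applyUpTo-truncate (h ∘ suc) 0 L (λ k _ → vanish (suc k) z≤n) z≤n)
sum-applyUpTo-truncate h (suc B) (suc L) vanish (s≤s B≤L) =
  cong (h 0 +_) (sum-applyUpTo-truncate (h ∘ suc) B L (λ k B≤k → vanish (suc k) (s≤s B≤k)) B≤L)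

p≤ : ℕ → ℕ → ℕ
p≤ m n = length (partsUpTo m n)

withCopies : ℕ → ℕ → ℕ → ℕ
withCopies m n k = if does (k * suc m ≤? n) then p≤ m (n ∸ k * suc m) else 0

p≤-suc : ∀ m n → p≤ (suc m) n ≡ sum (applyUpTo (withCopies m n) (suc n))
p≤-suc m n = begin
  p≤ (suc m) n
    ≡⟨ length-concatMap-filter (λ k → k * suc m ≤? n) G (upTo (suc n)) ⟩
  sum (map (λ k → if does (k * suc m ≤? n) then length (G k) else 0) (upTo (suc n)))
    ≡⟨ cong sum (map-cong (λ k → cong (λ ℓ → if does (k * suc m ≤? n) then ℓ else 0) (length-G k)) (upTo (suc n))) ⟩
  sum (map (withCopies m n) (upTo (suc n)))
    ≡⟨ cong sum (map-upTo (withCopies m n) (suc n)) ⟩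
  sum (applyUpTo (withCopies m n) (suc n))
    ∎
  where
  open ≡-Reasoning
  G = λ k → map (λ π → replicate k (suc m) ++ π) (partsUpTo m (n ∸ k * suc m))
  length-G : ∀ k → length (G k) ≡ p≤ m (n ∸ k * suc m)
  length-G k = length-map (λ π → replicate k (suc m) ++ π) (partsUpTo m (n ∸ k * suc m))

withCopies-≰ : ∀ m n k → ¬ (k * suc m ≤ n) → withCopies m n k ≡ 0
withCopies-≰ m n k ≰ = cong (λ b → if b then p≤ m (n ∸ k * suc m) else 0) (dec-false (k * suc m ≤? n) ≰)

withCopies-≤ : ∀ m n k → k * suc m ≤ n → withCopies m n k ≡ p≤ m (n ∸ k * suc m)
withCopies-≤ m n k ≤n = cong (λ b → if b then p≤ m (n ∸ k * suc m) else 0) (dec-true (k * suc m ≤? n) ≤n)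

withCopies-shift : ∀ m r k → withCopies m (suc m + r) (suc k) ≡ withCopies m r k
withCopies-shift m r k with k * suc m ≤? r
... | yes ≤r = begin
  withCopies m (suc m + r) (suc k)
    ≡⟨ withCopies-≤ m (suc m + r) (suc k) (+-monoʳ-≤ (suc m) ≤r) ⟩
  p≤ m (suc m + r ∸ (suc m + k * suc m))
    ≡⟨ cong (p≤ m) ([m+n]∸[m+o]≡n∸o (suc m) r (k * suc m)) ⟩
  p≤ m (r ∸ k * suc m)
    ≡⟨ withCopies-≤ m r k ≤r ⟨
  withCopies m r k
    ∎
  where open ≡-Reasoning
... | no ≰r = trans (withCopies-≰ m (suc m + r) (suc k) (≰r ∘ +-cancelˡ-≤ (suc m) _ _))
                   (sym (withCopies-≰ m r k ≰r))

p≤-suc-small : ∀ m n → n < suc m → p≤ (suc m) n ≡ p≤ m n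
p≤-suc-small m n n<s = begin
  p≤ (suc m) n
    ≡⟨ p≤-suc m n ⟩
  p≤ m n + sum (applyUpTo (withCopies m n ∘ suc) n)
    ≡⟨ cong (p≤ m n +_) (sum-applyUpTo-truncate (withCopies m n ∘ suc) 0 n none z≤n) ⟩
  p≤ m n + 0
    ≡⟨ +-identityʳ (p≤ m n) ⟩
  p≤ m n
    ∎
  where
  open ≡-Reasoning
  none : ∀ k → 0 ≤ k → withCopies m n (suc k) ≡ 0
  none k _ = withCopies-≰ m n (suc k) (<⇒≱ n<s ∘ ≤-trans (m≤m+n (suc m) (k * suc m)))

p≤-suc-large : ∀ m r → p≤ (suc m) (suc m + r) ≡ p≤ m (suc m + r) + p≤ (suc m) r
p≤-suc-large m r = begin
  p≤ (suc m) n
    ≡⟨ p≤-suc m n ⟩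
  p≤ m n + sum (applyUpTo (withCopies m n ∘ suc) n)
    ≡⟨ cong (p≤ m n +_) (sum-applyUpTo-cong n (withCopies-shift m r)) ⟩
  p≤ m n + sum (applyUpTo (withCopies m r) n)
    ≡⟨ cong (p≤ m n +_) (sum-applyUpTo-truncate (withCopies m r) (suc r) n beyond (s≤s (m≤n+m r m))) ⟩
  p≤ m n + sum (applyUpTo (withCopies m r) (suc r))
    ≡⟨ cong (p≤ m n +_) (p≤-suc m r) ⟨
  p≤ m n + p≤ (suc m) r
    ∎
  where
  open ≡-Reasoning
  n = suc m + r
  beyond : ∀ k → suc r ≤ k → withCopies m r k ≡ 0
  beyond k r<k = withCopies-≰ m r k (<⇒≱ (≤-trans r<k (m≤m*n k (suc m))))

p≤-stable : ∀ {j m} → j ≤ m → p≤ m j ≡ p≤ j j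
p≤-stable {j} j≤m = stable (≤⇒≤′ j≤m)
  where
  stable : ∀ {m} → j ≤′ m → p≤ m j ≡ p≤ j j
  stable ≤′-refl            = refl
  stable (≤′-step {m} j≤′m) = trans (p≤-suc-small m j (s≤s (≤′⇒≤ j≤′m))) (stable j≤′m)

p≤₂ : ℕ → Series
p≤₂ m n = parity (p≤ m n)

p₂ : Series
p₂ n = p≤₂ n n

[1+q^]-p≤₂ : ∀ m → [1+q^ suc m ]* p≤₂ (suc m) ≈ p≤₂ m
[1+q^]-p≤₂ m j with suc m ≤? j
... | no s≰j = begin
  p≤₂ (suc m) j +ℙ shift (suc m) (p≤₂ (suc m)) j
    ≡⟨ cong₂ _+ℙ_ (cong parity (p≤-suc-small m j (≰⇒> s≰j))) (shift-< (suc m) (p≤₂ (suc m)) (≰⇒> s≰j)) ⟩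
  p≤₂ m j +ℙ 0ℙ
    ≡⟨ ℙ.+-identityʳ (p≤₂ m j) ⟩
  p≤₂ m j
    ∎
  where open ≡-Reasoning
... | yes s≤j with m≤n⇒∃[o]m+o≡n s≤j
...   | r , refl = begin
  p≤₂ (suc m) (suc m + r) +ℙ shift (suc m) (p≤₂ (suc m)) (suc m + r)
    ≡⟨ cong₂ _+ℙ_ (trans (cong parity (p≤-suc-large m r)) (ℙ.+-homo-+ (p≤ m (suc m + r)) (p≤ (suc m) r)))
                  (shift-+-apply (suc m) (p≤₂ (suc m)) r) ⟩
  p≤₂ m (suc m + r) +ℙ p≤₂ (suc m) r +ℙ p≤₂ (suc m) r
    ≡⟨ x+y+y≡x (p≤₂ m (suc m + r)) (p≤₂ (suc m) r) ⟩
  p≤₂ m (suc m + r)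
    ∎
  where open ≡-Reasoning

poch-p≤₂ : ∀ k d → poch k d (p≤₂ (k + d)) ≈ p≤₂ k
poch-p≤₂ k zero    j = cong (λ m → p≤₂ m j) (+-identityʳ k)
poch-p≤₂ k (suc d) j = trans ([1+q^]-cong (suc k) inner j) ([1+q^]-p≤₂ k j)
  where
  inner : poch (suc k) d (p≤₂ (k + suc d)) ≈ p≤₂ (suc k)
  inner i = trans (poch-cong (suc k) d (λ i′ → cong (λ m → p≤₂ m i′) (+-suc k d)) i)
                  (poch-p≤₂ (suc k) d i)

pentagonal-recurrence : ∀ n {j} → j ≤ n → pentagonalSum n (p≤₂ n) j ≡ p≤₂ 0 j
pentagonal-recurrence n {j} j≤n = begin
  pentagonalSum n (p≤₂ n) j  ≡⟨ shanks n (p≤₂ n) j ⟨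
  shanksSum n (p≤₂ n) j      ≡⟨ shanksSum-low n (p≤₂ n) j≤n ⟩
  poch 0 n (p≤₂ n) j         ≡⟨ poch-p≤₂ 0 n j ⟩
  p≤₂ 0 j                    ∎
  where open ≡-Reasoning

-- An odd value of p between N and pent⁺ N

pent⁺≡pent⁻+1+k : ∀ k → pent⁺ k ≡ pent⁻ k + suc k
pent⁺≡pent⁻+1+k k = solve 2 (λ k t → (con 1 :+ k) :* (con 1 :+ k) :+ ((con 1 :+ k) :+ t)
                                   := (con 1 :+ k) :* (con 1 :+ k) :+ t :+ (con 1 :+ k)) refl k (tri k)

n<pent⁺n : ∀ n → n < pent⁺ n
n<pent⁺n n = ≤-trans (m≤m*n (suc n) (suc n)) (m≤m+n (suc n * suc n) (tri (suc n)))

pent⁻≤pent⁺ : ∀ k → pent⁻ k ≤ pent⁺ k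
pent⁻≤pent⁺ k = +-monoʳ-≤ (suc k * suc k) (m≤n+m (tri k) (suc k))

pent⁺<pent⁻ : ∀ k → pent⁺ k < pent⁻ (suc k)
pent⁺<pent⁻ k = +-monoˡ-< (tri (suc k)) (*-mono-< (n<1+n (suc k)) (n<1+n (suc k)))

pent⁻-mono-≤ : ∀ {m n} → m ≤ n → pent⁻ m ≤ pent⁻ n
pent⁻-mono-≤ {m} m≤n = mono (≤⇒≤′ m≤n)
  where
  mono : ∀ {n} → m ≤′ n → pent⁻ m ≤ pent⁻ n
  mono ≤′-refl            = ≤-refl
  mono (≤′-step {n} m≤′n) = ≤-trans (mono m≤′n) (<⇒≤ (≤-<-trans (pent⁻≤pent⁺ n) (pent⁺<pent⁻ n)))

pentagonalSum-above : ∀ f {n m j} → j < pent⁻ n → n ≤ m → pentagonalSum m f j ≡ pentagonalSum n f j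
pentagonalSum-above f {n} {j = j} j<n⁻ n≤m = above (≤⇒≤′ n≤m)
  where
  above : ∀ {m} → n ≤′ m → pentagonalSum m f j ≡ pentagonalSum n f j
  above ≤′-refl            = refl
  above (≤′-step {m} n≤′m) = begin
    pentagonalSum m f j +ℙ (shift (pent⁻ m) f j +ℙ shift (pent⁺ m) f j)
      ≡⟨ cong₂ (λ u v → pentagonalSum m f j +ℙ (u +ℙ v))
               (shift-< (pent⁻ m) f j<m⁻) (shift-< (pent⁺ m) f (<-≤-trans j<m⁻ (pent⁻≤pent⁺ m))) ⟩
    pentagonalSum m f j +ℙ 0ℙ
      ≡⟨ ℙ.+-identityʳ (pentagonalSum m f j) ⟩
    pentagonalSum m f j
      ≡⟨ above n≤′m ⟩
    pentagonalSum n f j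
      ∎
    where
    open ≡-Reasoning
    j<m⁻ = <-≤-trans j<n⁻ (pent⁻-mono-≤ (≤′⇒≤ n≤′m))

no-even-gap : ∀ N → ¬ (∀ m → N < m → m ≤ pent⁺ N → p₂ m ≡ 0ℙ)
no-even-gap N even = contradiction (begin
  1ℙ                           ≡⟨ top ⟨
  pentagonalSum (suc N) f W    ≡⟨ pentagonalSum-above f {suc N} (pent⁺<pent⁻ N) N<W ⟨
  pentagonalSum W f W          ≡⟨ pentagonal-recurrence W ≤-refl ⟩
  0ℙ                           ∎) λ ()
  where
  open ≡-Reasoning
  W = pent⁺ N
  f = p≤₂ W
  N<W = n<pent⁺n N
  W∸pent⁻≡1+N : W ∸ pent⁻ N ≡ suc N
  W∸pent⁻≡1+N = trans (cong (_∸ pent⁻ N) (pent⁺≡pent⁻+1+k N)) (m+n∸m≡n (pent⁻ N) (suc N))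
  f-shift : ∀ e → e ≤ W → shift e f W ≡ p₂ (W ∸ e)
  f-shift e e≤W = trans (shift-≥ e f e≤W) (cong parity (p≤-stable (m∸n≤m W e)))
  f-shift-even : ∀ e → e ≤ pent⁻ N → shift e f W ≡ 0ℙ
  f-shift-even e e≤ = trans (f-shift e (≤-trans e≤ (pent⁻≤pent⁺ N)))
    (even (W ∸ e) (subst (_≤ W ∸ e) W∸pent⁻≡1+N (∸-monoʳ-≤ W e≤)) (m∸n≤m W e))
  below : ∀ k → k ≤ N → pentagonalSum k f W ≡ 0ℙ
  below zero    _   = f-shift-even 0 z≤n
  below (suc k) k<N = cong₂ _+ℙ_ (below k (<⇒≤ k<N))
    (cong₂ _+ℙ_ (f-shift-even (pent⁻ k) (≤-trans (pent⁻≤pent⁺ k) pent⁺k≤)) (f-shift-even (pent⁺ k) pent⁺k≤))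
    where
    pent⁺k≤ : pent⁺ k ≤ pent⁻ N
    pent⁺k≤ = <⇒≤ (<-≤-trans (pent⁺<pent⁻ k) (pent⁻-mono-≤ k<N))
  top : pentagonalSum (suc N) f W ≡ 1ℙ
  top = cong₂ _+ℙ_ (below N ≤-refl)
    (cong₂ _+ℙ_ (trans (f-shift (pent⁻ N) (pent⁻≤pent⁺ N)) (trans (cong p₂ W∸pent⁻≡1+N) (even (suc N) ≤-refl N<W)))
                (trans (f-shift W ≤-refl) (cong p₂ (n∸n≡0 W))))

-- Counting the odd values of σmoex

moexSearch-odd : ∀ fuel c π → parity c ≡ 1ℙ → parity (moexSearch fuel c π) ≡ 1ℙ
moexSearch-odd zero       c π c-odd = c-odd
moexSearch-odd (suc fuel) c π c-odd with any (λ x → x ≡ᵇ c) π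
... | true  = moexSearch-odd fuel (2 + c) π c-odd
... | false = c-odd

parity-sum-odd : ∀ {a} {A : Set a} (g : A → ℕ) → (∀ x → parity (g x) ≡ 1ℙ) →
                 ∀ xs → parity (sum (map g xs)) ≡ parity (length xs)
parity-sum-odd g g-odd []       = refl
parity-sum-odd g g-odd (x ∷ xs) = begin
  parity (g x + sum (map g xs))            ≡⟨ ℙ.+-homo-+ (g x) (sum (map g xs)) ⟩
  parity (g x) +ℙ parity (sum (map g xs))  ≡⟨ cong₂ _+ℙ_ (g-odd x) (parity-sum-odd g g-odd xs) ⟩
  1ℙ +ℙ parity (length xs)                 ≡⟨ ℙ.+-homo-+ 1 (length xs) ⟨
  parity (suc (length xs))                 ∎
  where open ≡-Reasoning

parity-σmoex : ∀ n → parity (σmoex n) ≡ p₂ n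
parity-σmoex n = parity-sum-odd moex (λ π → moexSearch-odd (length π) 1 π refl) (partitions n)

parity≡1ℙ⇒%2≡1 : ∀ n → parity n ≡ 1ℙ → n % 2 ≡ 1
parity≡1ℙ⇒%2≡1 (suc zero)    _     = refl
parity≡1ℙ⇒%2≡1 (suc (suc n)) n-odd =
  trans (cong (_% 2) (+-comm 2 n)) (trans ([m+n]%n≡m%n n 2) (parity≡1ℙ⇒%2≡1 n n-odd))

≢1ℙ⇒≡0ℙ : ∀ {p} → p ≢ 1ℙ → p ≡ 0ℙ
≢1ℙ⇒≡0ℙ {0ℙ} _    = refl
≢1ℙ⇒≡0ℙ {1ℙ} ≢1ℙ = contradiction refl ≢1ℙ

module _ {p} {P : Pred ℕ p} (P? : Decidable P) where

  countUpTo : ℕ → ℕ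
  countUpTo X = length (filter P? (map suc (upTo X)))

  countUpTo-suc : ∀ X → countUpTo (suc X) ≡ countUpTo X + (if does (P? (suc X)) then 1 else 0)
  countUpTo-suc X = begin
    length (filter P? (map suc (upTo (suc X))))
      ≡⟨ cong (λ xs → length (filter P? (map suc xs))) (upTo-∷ʳ X) ⟨
    length (filter P? (map suc (upTo X ∷ʳ X)))
      ≡⟨ cong (length ∘ filter P?) (map-++ suc (upTo X) [ X ]) ⟩
    length (filter P? (map suc (upTo X) ++ [ suc X ]))
      ≡⟨ cong length (filter-++ P? (map suc (upTo X)) [ suc X ]) ⟩
    length (filter P? (map suc (upTo X)) ++ filter P? [ suc X ])
      ≡⟨ length-++ (filter P? (map suc (upTo X))) ⟩
    countUpTo X + length (filter P? [ suc X ])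
      ≡⟨ cong (countUpTo X +_) singleton ⟩
    countUpTo X + (if does (P? (suc X)) then 1 else 0)
      ∎
    where
    open ≡-Reasoning
    singleton : length (filter P? [ suc X ]) ≡ (if does (P? (suc X)) then 1 else 0)
    singleton with does (P? (suc X))
    ... | true  = refl
    ... | false = refl

  countUpTo-mono : ∀ {X Y} → X ≤ Y → countUpTo X ≤ countUpTo Y
  countUpTo-mono {X} X≤Y = mono (≤⇒≤′ X≤Y)
    where
    mono : ∀ {Y} → X ≤′ Y → countUpTo X ≤ countUpTo Y
    mono ≤′-refl            = ≤-refl
    mono (≤′-step {Y} X≤′Y) = ≤-trans (mono X≤′Y) (≤-trans (m≤m+n (countUpTo Y) _) (≤-reflexive (sym (countUpTo-suc Y))))

  countUpTo-< : ∀ {X m Y} → X < m → m ≤ Y → P m → countUpTo X < countUpTo Y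
  countUpTo-< {X} {suc m} {Y} (s≤s X≤m) m<Y Pm = begin-strict
    countUpTo X
      ≤⟨ countUpTo-mono X≤m ⟩
    countUpTo m
      <⟨ m<m+n (countUpTo m) z<s ⟩
    countUpTo m + 1
      ≡⟨ cong (λ b → countUpTo m + (if b then 1 else 0)) (dec-true (P? (suc m)) Pm) ⟨
    countUpTo m + (if does (P? (suc m)) then 1 else 0)
      ≡⟨ countUpTo-suc m ⟨
    countUpTo (suc m)
      ≤⟨ countUpTo-mono m<Y ⟩
    countUpTo Y
      ∎
    where open ≤-Reasoning

σmoex-odd? : Decidable (λ n → σmoex n % 2 ≡ 1)
σmoex-odd? n = σmoex n % 2 ≟ 1

oddCount-mono : ∀ {X Y} → X ≤ Y → oddCount X ≤ oddCount Y
oddCount-mono = countUpTo-mono σmoex-odd?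

oddCount-gap : ∀ N → oddCount N < oddCount (pent⁺ N)
oddCount-gap N = ≤∧≢⇒< (oddCount-mono (<⇒≤ (n<pent⁺n N))) (λ no-odd → no-even-gap N (even no-odd))
  where
  even : oddCount N ≡ oddCount (pent⁺ N) → ∀ m → N < m → m ≤ pent⁺ N → p₂ m ≡ 0ℙ
  even no-odd m N<m m≤W = ≢1ℙ⇒≡0ℙ λ odd →
    <-irrefl no-odd (countUpTo-< σmoex-odd? N<m m≤W (parity≡1ℙ⇒%2≡1 (σmoex m) (trans (parity-σmoex m) odd)))

tower : ℕ → ℕ
tower zero    = 1
tower (suc i) = pent⁺ (tower i)

oddCount-tower : ∀ i → suc i ≤ oddCount (tower i)
oddCount-tower zero    = s≤s z≤n
oddCount-tower (suc i) = ≤-<-trans (oddCount-tower i) (oddCount-gap (tower i))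

tri≤n*n : ∀ n → tri n ≤ n * n
tri≤n*n zero    = z≤n
tri≤n*n (suc n) = +-monoʳ-≤ (suc n) (≤-trans (tri≤n*n n) (*-monoʳ-≤ n (n≤1+n n)))

8*pent⁺≤[8*n]² : ∀ n → 1 ≤ n → 8 * pent⁺ n ≤ (8 * n) * (8 * n)
8*pent⁺≤[8*n]² n 1≤n = begin
  8 * (x * x + tri x)
    ≤⟨ *-monoʳ-≤ 8 (+-monoʳ-≤ (x * x) (tri≤n*n x)) ⟩
  8 * (x * x + x * x)
    ≤⟨ *-monoʳ-≤ 8 (+-mono-≤ (*-mono-≤ x≤2n x≤2n) (*-mono-≤ x≤2n x≤2n)) ⟩
  8 * ((n + n) * (n + n) + (n + n) * (n + n))
    ≡⟨ solve 1 (λ n → con 8 :* ((n :+ n) :* (n :+ n) :+ (n :+ n) :* (n :+ n)) := (con 8 :* n) :* (con 8 :* n)) refl n ⟩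
  (8 * n) * (8 * n)
    ∎
  where
  open ≤-Reasoning
  x = suc n
  x≤2n : x ≤ n + n
  x≤2n = ≤-trans (≤-reflexive (+-comm 1 n)) (+-monoʳ-≤ n 1≤n)

8*tower≤2^2^[2+i] : ∀ i → 8 * tower i ≤ 2 ^ 2 ^ (2 + i)
8*tower≤2^2^[2+i] zero    = m≤m+n 8 8
8*tower≤2^2^[2+i] (suc i) = begin
  8 * pent⁺ (tower i)           ≤⟨ 8*pent⁺≤[8*n]² (tower i) (tower≥1 i) ⟩
  (8 * tower i) * (8 * tower i) ≤⟨ *-mono-≤ (8*tower≤2^2^[2+i] i) (8*tower≤2^2^[2+i] i) ⟩
  2 ^ e * 2 ^ e                 ≡⟨ ^-distribˡ-+-* 2 e e ⟨
  2 ^ (e + e)                   ≡⟨ cong (λ e′ → 2 ^ (e + e′)) (+-identityʳ e) ⟨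
  2 ^ 2 ^ (2 + suc i)           ∎
  where
  open ≤-Reasoning
  e = 2 ^ (2 + i)
  tower≥1 : ∀ i → 1 ≤ tower i
  tower≥1 zero    = s≤s z≤n
  tower≥1 (suc i) = s≤s z≤n

loglog-≤ : ∀ {X} e → X ≤ 2 ^ 2 ^ e → ⌊log₂ ⌊log₂ X ⌋ ⌋ ≤ e
loglog-≤ {X} e X≤ = begin
  ⌊log₂ ⌊log₂ X ⌋ ⌋          ≤⟨ ⌊log₂⌋-mono-≤ (⌊log₂⌋-mono-≤ X≤) ⟩
  ⌊log₂ ⌊log₂ 2 ^ 2 ^ e ⌋ ⌋  ≡⟨ cong ⌊log₂_⌋ (⌊log₂[2^n]⌋≡n (2 ^ e)) ⟩
  ⌊log₂ 2 ^ e ⌋              ≡⟨ ⌊log₂[2^n]⌋≡n e ⟩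
  e                          ∎
  where open ≤-Reasoning

tower≤ : ∀ {X} i → 3 + i ≤ ⌊log₂ ⌊log₂ X ⌋ ⌋ → tower i ≤ X
tower≤ {X} i 3+i≤ with tower i ≤? X
... | yes ≤X = ≤X
... | no  ≰X = contradiction (≤-trans 3+i≤ (loglog-≤ (2 + i) X≤)) (n≮n (2 + i))
  where
  X≤ : X ≤ 2 ^ 2 ^ (2 + i)
  X≤ = ≤-trans (<⇒≤ (≰⇒> ≰X)) (≤-trans (m≤n*m (tower i) 8) (8*tower≤2^2^[2+i] i))

loglog≤3*oddCount : ∀ X → 1 ≤ X → ⌊log₂ ⌊log₂ X ⌋ ⌋ ≤ 3 * oddCount X
loglog≤3*oddCount X 1≤X = bound ⌊log₂ ⌊log₂ X ⌋ ⌋ ≤-refl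
  where
  3≤3*oddCount : 3 ≤ 3 * oddCount X
  3≤3*oddCount = *-monoʳ-≤ 3 (≤-trans (oddCount-tower 0) (oddCount-mono 1≤X))
  bound : ∀ L → L ≤ ⌊log₂ ⌊log₂ X ⌋ ⌋ → L ≤ 3 * oddCount X
  bound 0 _ = z≤n
  bound 1 _ = ≤-trans (s≤s z≤n) 3≤3*oddCount
  bound 2 _ = ≤-trans (s≤s (s≤s z≤n)) 3≤3*oddCount
  bound (suc (suc (suc i))) 3+i≤ = begin
    3 + i              ≤⟨ +-monoʳ-≤ 3 (m≤n*m i 3) ⟩
    3 + 3 * i          ≡⟨ *-suc 3 i ⟨
    3 * suc i          ≤⟨ *-monoʳ-≤ 3 (≤-trans (oddCount-tower i) (oddCount-mono (tower≤ {X} i 3+i≤))) ⟩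
    3 * oddCount X     ∎
    where open ≤-Reasoning

theorem1p5 : ∃[ p ] ∃[ q ] (0 < p × 0 < q × ∃[ X₀ ] (∀ X → X₀ ≤ X →
               p * ⌊log₂ ⌊log₂ X ⌋ ⌋ ≤ q * oddCount X))
theorem1p5 = 1 , 3 , z<s , z<s , 1 , λ X 1≤X →
  ≤-trans (≤-reflexive (*-identityˡ _)) (loglog≤3*oddCount X 1≤X)
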